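{- Let $n$ be even, let $A$ be an abelian group of order $n$ that is not an elementary abelian $2$-group, and let $G=D(A)=\langle x,A\mid x^2=1,\ xax=a^{ -1}\ \forall a\in A\rangle$ act on the $n$ left cosets of $H=\langle x\rangle$, so $G\le\mathrm{Sym}(n)$. Suppose $A\not\le\mathrm{Alt}(n)$, and let $\tau\in xA\cap\mathrm{Der}(G)$. If $C$ is an inverse-closed set with $\big((A\cap\mathrm{Alt}(n))\cup\tau(A\cap\mathrm{Alt}(n))\big)\setminus\{1\}\subseteq C\subseteq\mathrm{Der}(G)$, then $\alpha(\mathrm{Cay}(G,C))=\alpha(\Gamma_G)=2$.
   Context: A derangement is an element fixing no coset; $\mathrm{Der}(G)$ is the set of derangements; $\mathrm{Alt}(n)$ is the set of even permutations. For inverse-closed $S\subseteq G$ not containing the identity, $\mathrm{Cay}(G,S)$ is the graph on $G$ with $g,h$ adjacent iff $g^{ -1}h\in S$; $\Gamma_G=\mathrm{Cay}(G,\mathrm{Der}(G))$; $\alpha$ denotes independence number. -}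

module Defs where

open import Level using (Level; _⊔_)
open import Algebra.Bundles using (AbelianGroup)
open import Data.Bool using (Bool; true; false; _xor_)
open import Data.Product using (_×_; _,_; proj₁; proj₂; ∃; ∃-syntax)
open import Data.Nat using (ℕ; _≤_)
open import Data.Nat.Divisibility using (_∣_)
open import Data.Fin using (Fin)
open import Data.Fin.Properties using (_<?_)
open import Data.List using (List; length; filter; cartesianProduct; allFin)
open import Data.List.Relation.Unary.AllPairs using (AllPairs)
open import Relation.Nullary using (¬_)
open import Relation.Nullary.Decidable using (_×-dec_)
open import Relation.Binary.PropositionalEquality as ≡ using (_≡_)
open import Function.Bundles using (Inverse)

module DA {c ℓ : Level} (𝔸 : AbelianGroup c ℓ) where
  open AbelianGroup 𝔸 renaming (Carrier to A)

  pw : Bool → A → A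
  pw false b = b
  pw true  b = b ⁻¹

  -- Element (a , e) of D(A) stands for a·x^e  (every element is uniquely of this form).
  G : Set c
  G = A × Bool

  -- a x^e · b x^f = a (x^e b x^e) x^(e+f) = a b^{(-1)^e} x^(e+f)
  _·_ : G → G → G
  (a , e) · (b , f) = (a ∙ pw e b , e xor f)

  -- (a x^e)⁻¹ = x^e a⁻¹ = (a⁻¹)^{(-1)^e} x^e
  inv : G → G
  inv (a , e) = (pw e (a ⁻¹) , e)

  one : G
  one = (ε , false)

  xG : G
  xG = (ε , true)

  ι : A → G
  ι a = (a , false)

  _≈G_ : G → G → Set ℓ
  (a , e) ≈G (b , f) = (a ≈ b) × (e ≡ f)

  -- Left cosets of H = <x>: the coset g H with g = a x^e equals a H, so the
  -- left cosets are labelled bijectively by A via  a ↦ a H.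
  -- cosetLabel g = the label of the coset g H.
  cosetLabel : G → A
  cosetLabel (a , e) = a

  -- action of g on the coset labelled b:  g · (b H) = (g b) H
  act : G → A → A
  act g b = cosetLabel (g · ι b)

  Der : G → Set (c ⊔ ℓ)
  Der g = ∀ b → ¬ (act g b ≈ b)

  module _ {n : ℕ} (en : Inverse (≡.setoid (Fin n)) setoid) where
    open Inverse en using (to; from)

    perm : G → Fin n → Fin n
    perm g i = from (act g (to i))

    inversions : (Fin n → Fin n) → ℕ
    inversions π =
      length (filter (λ p → (proj₁ p <? proj₂ p) ×-dec (π (proj₂ p) <? π (proj₁ p)))
                     (cartesianProduct (allFin n) (allFin n)))

    Alt : G → Set
    Alt g = 2 ∣ inversions (perm g)

  module _ {p : Level} (S : G → Set p) where
    Adj : G → G → Set p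
    Adj g h = S (inv g · h)

    Independent : List G → Set (c ⊔ ℓ ⊔ p)
    Independent = AllPairs (λ g h → ¬ (g ≈G h) × ¬ Adj g h × ¬ Adj h g)

    IndepNumber≡ : ℕ → Set (c ⊔ ℓ ⊔ p)
    IndepNumber≡ k =
      (∃[ L ] (Independent L × length L ≡ k)) ×
      (∀ L → Independent L → length L ≤ k)

-- Two of any three elements of D(A) lie in the same coset of A, and their quotient is a
-- nontrivial element of A, which acts on the cosets of H as a fixed-point-free translation;
-- so Γ_G has no independent set of size 3, while {1, x} is independent in every Cay(G, C)
-- with C ⊆ Der(G) because x fixes the coset H.  For C, the sign of the translation action
-- is a character of A; extended to D(A) so that τ has sign 0 it becomes a character φ whose
-- kernel ⟨A ∩ Alt(n), τ⟩ lies in C ∪ {1}.  Hence non-adjacent vertices have different values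
-- of φ, and no three vertices are pairwise non-adjacent.
module Submission where

open import Defs
open import Level using (Level)
open import Algebra.Bundles using (AbelianGroup; CommutativeMonoid; CommutativeRing)
open import Data.Bool using (Bool; true; false; not; _∧_; _xor_)
open import Data.Bool.Properties
  using (xor-∧-commutativeRing; xor-comm; xor-same; xor-inverseʳ; xor-annihilates-not;
         not-involutive; ∧-distribˡ-xor; ∧-distribʳ-xor)
open import Data.Product using (_×_; _,_; ∃-syntax; proj₂)
open import Data.Sum using (_⊎_; inj₁; inj₂)
open import Data.Nat using (ℕ; zero; suc; _≤_; z≤n; s≤s)
open import Data.Nat.Divisibility using (_∣_; divides; ∣m∣n⇒∣m+n; ∣-refl)
open import Data.Fin using (Fin)
open import Data.Fin.Properties using (_<?_; _≟_; <-cmp; <-irrefl)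
open import Data.Fin.Permutation using (Permutation; permutation; _⟨$⟩ʳ_; _∘ₚ_)
open import Data.List using (List; []; _∷_; _++_; map; foldr; length; filter; cartesianProduct; allFin; tabulate)
open import Data.List.Properties using (map-++; map-∘; map-tabulate)
open import Data.List.Relation.Unary.AllPairs using ([]; _∷_)
open import Data.List.Relation.Unary.All using ([]; _∷_)
open import Data.Empty using (⊥-elim)
open import Relation.Nullary using (¬_; does; yes; no)
open import Relation.Nullary.Decidable using (dec-true; dec-false)
open import Relation.Unary using (Decidable)
open import Relation.Binary using (tri<; tri≈; tri>)
open import Relation.Binary.PropositionalEquality as ≡
  using (_≡_; _≢_; _≗_; refl; sym; trans; cong; cong₂; module ≡-Reasoning)
open import Function using (_∘_; Injective; Inverse; Injection)
open import Function.Properties.Inverse using (↔⇒↣)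
import Algebra.Properties.Group as GroupProperties
import Algebra.Properties.CommutativeSemigroup as CommutativeSemigroupProperties
import Algebra.Properties.CommutativeMonoid.Sum as CommutativeMonoidSum
import Relation.Binary.Reasoning.Setoid as SetoidReasoning

xor-commutativeMonoid : CommutativeMonoid _ _
xor-commutativeMonoid = CommutativeRing.+-commutativeMonoid xor-∧-commutativeRing

open CommutativeMonoidSum xor-commutativeMonoid using (sum; sum-cong-≗; ∑-comm; ∑-distrib-+; ∑-permute)
open CommutativeSemigroupProperties (CommutativeMonoid.commutativeSemigroup xor-commutativeMonoid)
  using (interchange)

xor≡false⇒≡ : ∀ x y → x xor y ≡ false → x ≡ y
xor≡false⇒≡ false y x⊕y≡0 = sym x⊕y≡0
xor≡false⇒≡ true true _ = refl

xor-cancel-middle : ∀ x y z → x xor z ≡ (x xor y) xor (y xor z)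
xor-cancel-middle true true z = refl
xor-cancel-middle true false z = refl
xor-cancel-middle false true z = sym (not-involutive z)
xor-cancel-middle false false z = refl

∧-cong-true : ∀ b {x y} → (b ≡ true → x ≡ y) → b ∧ x ≡ b ∧ y
∧-cong-true false _ = refl
∧-cong-true true x≡y = x≡y refl

pigeonhole : ∀ (x y z : Bool) → x ≡ y ⊎ x ≡ z ⊎ y ≡ z
pigeonhole true true z = inj₁ refl
pigeonhole false false z = inj₁ refl
pigeonhole true false true = inj₂ (inj₁ refl)
pigeonhole true false false = inj₂ (inj₂ refl)
pigeonhole false true true = inj₂ (inj₂ refl)
pigeonhole false true false = inj₂ (inj₁ refl)

odd : ℕ → Bool
odd zero = false
odd (suc m) = not (odd m)

¬odd⇒2∣ : ∀ m → odd m ≡ false → 2 ∣ m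
¬odd⇒2∣ zero _ = divides 0 refl
¬odd⇒2∣ (suc (suc m)) even =
  ∣m∣n⇒∣m+n ∣-refl (¬odd⇒2∣ m (trans (sym (not-involutive (odd m))) even))

xorSum : List Bool → Bool
xorSum = foldr _xor_ false

odd-length-filter : ∀ {a p} {X : Set a} {Q : X → Set p} (Q? : Decidable Q) xs →
                    odd (length (filter Q? xs)) ≡ xorSum (map (does ∘ Q?) xs)
odd-length-filter Q? [] = refl
odd-length-filter Q? (x ∷ xs) with does (Q? x)
... | false = odd-length-filter Q? xs
... | true = cong not (odd-length-filter Q? xs)

xorSum-++ : ∀ xs ys → xorSum (xs ++ ys) ≡ xorSum xs xor xorSum ys
xorSum-++ [] ys = refl
xorSum-++ (x ∷ xs) ys =
  trans (cong (x xor_) (xorSum-++ xs ys)) (sym (CommutativeMonoid.assoc xor-commutativeMonoid x _ _))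

xorSum-tabulate : ∀ {n} (f : Fin n → Bool) → xorSum (tabulate f) ≡ sum f
xorSum-tabulate {zero} f = refl
xorSum-tabulate {suc n} f = cong (f Fin.zero xor_) (xorSum-tabulate (f ∘ Fin.suc))

xorSum-cartesianProduct : ∀ {a b} {X : Set a} {Y : Set b} {m} (f : Fin m → X) (ys : List Y)
  (h : X × Y → Bool) →
  xorSum (map h (cartesianProduct (tabulate f) ys)) ≡ sum (λ i → xorSum (map (λ y → h (f i , y)) ys))
xorSum-cartesianProduct {m = zero} f ys h = refl
xorSum-cartesianProduct {m = suc m} f ys h = begin
  xorSum (map h (map (f Fin.zero ,_) ys ++ cartesianProduct (tabulate (f ∘ Fin.suc)) ys))
    ≡⟨ cong xorSum (map-++ h (map (f Fin.zero ,_) ys) _) ⟩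
  xorSum (map h (map (f Fin.zero ,_) ys) ++ map h (cartesianProduct (tabulate (f ∘ Fin.suc)) ys))
    ≡⟨ xorSum-++ (map h (map (f Fin.zero ,_) ys)) _ ⟩
  xorSum (map h (map (f Fin.zero ,_) ys)) xor xorSum (map h (cartesianProduct (tabulate (f ∘ Fin.suc)) ys))
    ≡⟨ cong₂ _xor_ (cong xorSum (sym (map-∘ ys))) (xorSum-cartesianProduct (f ∘ Fin.suc) ys h) ⟩
  sum (λ i → xorSum (map (λ y → h (f i , y)) ys)) ∎
  where open ≡-Reasoning

module _ {n : ℕ} where

  ∑∑ : (Fin n → Fin n → Bool) → Bool
  ∑∑ T = sum (λ i → sum (λ j → T i j))

  ∑∑-cong : ∀ {T U : Fin n → Fin n → Bool} → (∀ i j → T i j ≡ U i j) → ∑∑ T ≡ ∑∑ U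
  ∑∑-cong T≡U = sum-cong-≗ (λ i → sum-cong-≗ (T≡U i))

  ∑∑-distrib-xor : ∀ (T U : Fin n → Fin n → Bool) →
                   ∑∑ (λ i j → T i j xor U i j) ≡ ∑∑ T xor ∑∑ U
  ∑∑-distrib-xor T U =
    trans (sum-cong-≗ (λ i → ∑-distrib-+ (T i) (U i))) (∑-distrib-+ (λ i → sum (T i)) (λ i → sum (U i)))

  ∑∑-permute : ∀ (T : Fin n → Fin n → Bool) (σ : Permutation n n) →
               ∑∑ T ≡ ∑∑ (λ i j → T (σ ⟨$⟩ʳ i) (σ ⟨$⟩ʳ j))
  ∑∑-permute T σ = trans (sum-cong-≗ (λ k → ∑-permute (T k) σ)) (∑-permute _ σ)

  odd-length-filter-pairs : ∀ {p} {Q : Fin n × Fin n → Set p} (Q? : Decidable Q) →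
    odd (length (filter Q? (cartesianProduct (allFin n) (allFin n)))) ≡ ∑∑ (λ i j → does (Q? (i , j)))
  odd-length-filter-pairs Q? = begin
    odd (length (filter Q? (cartesianProduct (allFin n) (allFin n))))
      ≡⟨ odd-length-filter Q? (cartesianProduct (allFin n) (allFin n)) ⟩
    xorSum (map (does ∘ Q?) (cartesianProduct (allFin n) (allFin n)))
      ≡⟨ xorSum-cartesianProduct (λ i → i) (allFin n) (does ∘ Q?) ⟩
    sum (λ i → xorSum (map (λ j → does (Q? (i , j))) (allFin n)))
      ≡⟨ sum-cong-≗ (λ i → cong xorSum (map-tabulate (λ j → j) (λ j → does (Q? (i , j))))) ⟩
    sum (λ i → xorSum (tabulate (λ j → does (Q? (i , j)))))
      ≡⟨ sum-cong-≗ (λ i → xorSum-tabulate (λ j → does (Q? (i , j)))) ⟩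
    ∑∑ (λ i j → does (Q? (i , j))) ∎
    where open ≡-Reasoning

  infix 7 _<ᵇ_
  _<ᵇ_ : Fin n → Fin n → Bool
  i <ᵇ j = does (i <? j)

  <ᵇ-irrefl : ∀ i → (i <ᵇ i) ≡ false
  <ᵇ-irrefl i = dec-false (i <? i) (<-irrefl refl)

  <ᵇ⇒≢ : ∀ {i j} → (i <ᵇ j) ≡ true → i ≢ j
  <ᵇ⇒≢ {i} i<j refl with trans (sym i<j) (<ᵇ-irrefl i)
  ... | ()

  <ᵇ-flip : ∀ i j → i ≢ j → (j <ᵇ i) ≡ not (i <ᵇ j)
  <ᵇ-flip i j i≢j with <-cmp i j
  ... | tri< i<j _ j≮i = trans (dec-false (j <? i) j≮i) (cong not (sym (dec-true (i <? j) i<j)))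
  ... | tri≈ _ i≡j _ = ⊥-elim (i≢j i≡j)
  ... | tri> i≮j _ j<i = trans (dec-true (j <? i) j<i) (cong not (sym (dec-false (i <? j) i≮j)))

  ∑∑-symmetric : ∀ (T : Fin n → Fin n → Bool) → (∀ i → T i i ≡ false) → (∀ i j → T i j ≡ T j i) →
                 ∑∑ T ≡ false
  ∑∑-symmetric T diagonal symmetric = begin
    ∑∑ T
      ≡⟨ ∑∑-cong split ⟩
    ∑∑ (λ i j → (i <ᵇ j ∧ T i j) xor (j <ᵇ i ∧ T i j))
      ≡⟨ ∑∑-distrib-xor _ _ ⟩
    ∑∑ upper xor ∑∑ (λ i j → j <ᵇ i ∧ T i j)
      ≡⟨ cong (∑∑ upper xor_) (∑-comm (λ i j → j <ᵇ i ∧ T i j)) ⟩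
    ∑∑ upper xor ∑∑ (λ i j → i <ᵇ j ∧ T j i)
      ≡⟨ cong (∑∑ upper xor_) (∑∑-cong (λ i j → cong (i <ᵇ j ∧_) (symmetric j i))) ⟩
    ∑∑ upper xor ∑∑ upper
      ≡⟨ xor-same (∑∑ upper) ⟩
    false ∎
    where
      open ≡-Reasoning
      upper : Fin n → Fin n → Bool
      upper i j = i <ᵇ j ∧ T i j
      split : ∀ i j → T i j ≡ (i <ᵇ j ∧ T i j) xor (j <ᵇ i ∧ T i j)
      split i j with i ≟ j
      ... | yes refl = trans (diagonal i) (sym (xor-same (i <ᵇ i ∧ T i i)))
      ... | no i≢j = begin
        T i j                                   ≡⟨⟩
        true ∧ T i j                            ≡⟨ cong (_∧ T i j) (sym (xor-inverseʳ (i <ᵇ j))) ⟩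
        ((i <ᵇ j) xor not (i <ᵇ j)) ∧ T i j     ≡⟨ cong (λ x → ((i <ᵇ j) xor x) ∧ T i j) (<ᵇ-flip i j i≢j) ⟨
        ((i <ᵇ j) xor (j <ᵇ i)) ∧ T i j         ≡⟨ ∧-distribʳ-xor (T i j) (i <ᵇ j) (j <ᵇ i) ⟩
        (i <ᵇ j ∧ T i j) xor (j <ᵇ i ∧ T i j)   ∎

  inversionParity : (Fin n → Fin n) → Bool
  inversionParity f = ∑∑ (λ i j → i <ᵇ j ∧ f j <ᵇ f i)

  inversionParity-cong : ∀ {f g} → f ≗ g → inversionParity f ≡ inversionParity g
  inversionParity-cong f≗g = ∑∑-cong (λ i j → cong₂ (λ x y → i <ᵇ j ∧ x <ᵇ y) (f≗g j) (f≗g i))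

  flips : (Fin n → Fin n) → Fin n → Fin n → Bool
  flips f i j = (i <ᵇ j) xor (f i <ᵇ f j)

  flips-diagonal : ∀ f i → flips f i i ≡ false
  flips-diagonal f i = cong₂ _xor_ (<ᵇ-irrefl i) (<ᵇ-irrefl (f i))

  flips-sym : ∀ {f} → Injective _≡_ _≡_ f → ∀ i j → flips f i j ≡ flips f j i
  flips-sym {f} f-inj i j with i ≟ j
  ... | yes refl = refl
  ... | no i≢j = sym (trans (cong₂ _xor_ (<ᵇ-flip i j i≢j) (<ᵇ-flip (f i) (f j) (i≢j ∘ f-inj)))
                            (xor-annihilates-not (i <ᵇ j) (f i <ᵇ f j)))

  flips-∘ : ∀ f g i j → flips (f ∘ g) i j ≡ flips g i j xor flips f (g i) (g j)
  flips-∘ f g i j = xor-cancel-middle (i <ᵇ j) (g i <ᵇ g j) (f (g i) <ᵇ f (g j))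

  inversionParity-flips : ∀ {f} → Injective _≡_ _≡_ f →
                          inversionParity f ≡ ∑∑ (λ i j → i <ᵇ j ∧ flips f i j)
  inversionParity-flips {f} f-inj = ∑∑-cong λ i j → ∧-cong-true (i <ᵇ j) λ i<j →
    trans (<ᵇ-flip (f i) (f j) (<ᵇ⇒≢ i<j ∘ f-inj)) (cong (λ b → b xor (f i <ᵇ f j)) (sym i<j))

  -- The terms before and after reindexing differ by the symmetric term flips σ i j ∧ S (σ i) (σ j).
  ∑∑-reindex-upper : ∀ (σ : Permutation n n) (S : Fin n → Fin n → Bool) → (∀ i j → S i j ≡ S j i) →
    ∑∑ (λ i j → i <ᵇ j ∧ S (σ ⟨$⟩ʳ i) (σ ⟨$⟩ʳ j)) ≡ ∑∑ (λ i j → i <ᵇ j ∧ S i j)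
  ∑∑-reindex-upper σ S S-sym = xor≡false⇒≡ _ _ (begin
    ∑∑ (λ i j → i <ᵇ j ∧ S (σʳ i) (σʳ j)) xor ∑∑ (λ i j → i <ᵇ j ∧ S i j)
      ≡⟨ cong (∑∑ (λ i j → i <ᵇ j ∧ S (σʳ i) (σʳ j)) xor_) (∑∑-permute (λ i j → i <ᵇ j ∧ S i j) σ) ⟩
    ∑∑ (λ i j → i <ᵇ j ∧ S (σʳ i) (σʳ j)) xor ∑∑ (λ i j → σʳ i <ᵇ σʳ j ∧ S (σʳ i) (σʳ j))
      ≡⟨ sym (∑∑-distrib-xor _ _) ⟩
    ∑∑ (λ i j → (i <ᵇ j ∧ S (σʳ i) (σʳ j)) xor (σʳ i <ᵇ σʳ j ∧ S (σʳ i) (σʳ j)))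
      ≡⟨ ∑∑-cong (λ i j → sym (∧-distribʳ-xor (S (σʳ i) (σʳ j)) (i <ᵇ j) (σʳ i <ᵇ σʳ j))) ⟩
    ∑∑ (λ i j → flips σʳ i j ∧ S (σʳ i) (σʳ j))
      ≡⟨ ∑∑-symmetric _ (λ i → cong (_∧ S (σʳ i) (σʳ i)) (flips-diagonal σʳ i))
                        (λ i j → cong₂ _∧_ (flips-sym σ-inj i j) (S-sym (σʳ i) (σʳ j))) ⟩
    false ∎)
    where
      open ≡-Reasoning
      σʳ = σ ⟨$⟩ʳ_
      σ-inj = Injection.injective (↔⇒↣ σ)

  inversionParity-∘ : ∀ (π σ : Permutation n n) →
    inversionParity ((π ⟨$⟩ʳ_) ∘ (σ ⟨$⟩ʳ_))
      ≡ inversionParity (σ ⟨$⟩ʳ_) xor inversionParity (π ⟨$⟩ʳ_)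
  inversionParity-∘ π σ = begin
    inversionParity (πʳ ∘ σʳ)
      ≡⟨ inversionParity-flips (Injection.injective (↔⇒↣ (σ ∘ₚ π))) ⟩
    ∑∑ (λ i j → i <ᵇ j ∧ flips (πʳ ∘ σʳ) i j)
      ≡⟨ ∑∑-cong (λ i j →
           trans (cong (i <ᵇ j ∧_) (flips-∘ πʳ σʳ i j)) (∧-distribˡ-xor (i <ᵇ j) _ _)) ⟩
    ∑∑ (λ i j → (i <ᵇ j ∧ flips σʳ i j) xor (i <ᵇ j ∧ flips πʳ (σʳ i) (σʳ j)))
      ≡⟨ ∑∑-distrib-xor _ _ ⟩
    ∑∑ (λ i j → i <ᵇ j ∧ flips σʳ i j) xor ∑∑ (λ i j → i <ᵇ j ∧ flips πʳ (σʳ i) (σʳ j))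
      ≡⟨ cong₂ _xor_ (sym (inversionParity-flips σ-inj))
                     (∑∑-reindex-upper σ (flips πʳ) (flips-sym π-inj)) ⟩
    inversionParity σʳ xor ∑∑ (λ i j → i <ᵇ j ∧ flips πʳ i j)
      ≡⟨ cong (inversionParity σʳ xor_) (sym (inversionParity-flips π-inj)) ⟩
    inversionParity σʳ xor inversionParity πʳ ∎
    where
      open ≡-Reasoning
      πʳ = π ⟨$⟩ʳ_
      σʳ = σ ⟨$⟩ʳ_
      π-inj = Injection.injective (↔⇒↣ π)
      σ-inj = Injection.injective (↔⇒↣ σ)

module Dihedral {c ℓ : Level} (𝔸 : AbelianGroup c ℓ) where
  open AbelianGroup 𝔸 renaming (Carrier to A; refl to ≈-refl; sym to ≈-sym; trans to ≈-trans)
  open DA 𝔸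
  open GroupProperties group using (⁻¹-involutive; x∙y⁻¹≈ε⇒x≈y; ∙-cancelʳ)

  module Character (χ : A → Bool) (χ-cong : ∀ {a b} → a ≈ b → χ a ≡ χ b)
                   (χ-∙ : ∀ a b → χ (a ∙ b) ≡ χ a xor χ b) where

    χ-ε : χ ε ≡ false
    χ-ε = trans (χ-cong (≈-sym (identityˡ ε))) (trans (χ-∙ ε ε) (xor-same (χ ε)))

    χ-⁻¹ : ∀ a → χ (a ⁻¹) ≡ χ a
    χ-⁻¹ a = sym (xor≡false⇒≡ (χ a) (χ (a ⁻¹))
                 (trans (sym (χ-∙ a (a ⁻¹))) (trans (χ-cong (inverseʳ a)) χ-ε)))

    χ-pw : ∀ e a → χ (pw e a) ≡ χ a
    χ-pw false a = refl
    χ-pw true a = χ-⁻¹ a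

    extend : Bool → G → Bool
    extend s (a , e) = (e ∧ s) xor χ a

    extend-· : ∀ s g h → extend s (g · h) ≡ extend s g xor extend s h
    extend-· s (a , e) (b , f) = begin
      ((e xor f) ∧ s) xor χ (a ∙ pw e b)       ≡⟨ cong₂ _xor_ (∧-distribʳ-xor s e f) (χ-∙ a (pw e b)) ⟩
      ((e ∧ s) xor (f ∧ s)) xor (χ a xor χ (pw e b))
                                              ≡⟨ cong (λ y → ((e ∧ s) xor (f ∧ s)) xor (χ a xor y)) (χ-pw e b) ⟩
      ((e ∧ s) xor (f ∧ s)) xor (χ a xor χ b) ≡⟨ interchange (e ∧ s) (f ∧ s) (χ a) (χ b) ⟩
      ((e ∧ s) xor χ a) xor ((f ∧ s) xor χ b) ∎
      where open ≡-Reasoning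

    extend-inv : ∀ s g → extend s (inv g) ≡ extend s g
    extend-inv s (a , e) = cong ((e ∧ s) xor_) (trans (χ-pw e (a ⁻¹)) (χ-⁻¹ a))

  module Sign {n : ℕ} (en : Inverse (≡.setoid (Fin n)) setoid) where
    open Inverse en using (to; from; from-cong; strictlyInverseˡ; strictlyInverseʳ)

    translate-cancel : ∀ a b → a ∙ b ≈ ε → ∀ i → from (a ∙ to (from (b ∙ to i))) ≡ i
    translate-cancel a b a∙b≈ε i = trans (from-cong (begin
      a ∙ to (from (b ∙ to i)) ≈⟨ ∙-congˡ (strictlyInverseˡ (b ∙ to i)) ⟩
      a ∙ (b ∙ to i)           ≈⟨ assoc a b (to i) ⟨
      (a ∙ b) ∙ to i           ≈⟨ ∙-congʳ a∙b≈ε ⟩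
      ε ∙ to i                 ≈⟨ identityˡ (to i) ⟩
      to i                     ∎)) (strictlyInverseʳ i)
      where open SetoidReasoning setoid

    translation : A → Permutation n n
    translation a = permutation (λ i → from (a ∙ to i)) (λ i → from (a ⁻¹ ∙ to i))
                                (translate-cancel a (a ⁻¹) (inverseʳ a))
                                (translate-cancel (a ⁻¹) a (inverseˡ a))

    sgn : A → Bool
    sgn a = inversionParity (translation a ⟨$⟩ʳ_)

    sgn-cong : ∀ {a b} → a ≈ b → sgn a ≡ sgn b
    sgn-cong a≈b = inversionParity-cong (λ i → from-cong (∙-congʳ a≈b))

    sgn-∙ : ∀ a b → sgn (a ∙ b) ≡ sgn a xor sgn b
    sgn-∙ a b = begin
      sgn (a ∙ b)
        ≡⟨ inversionParity-cong (λ i →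
             from-cong (≈-trans (assoc a b (to i)) (∙-congˡ (≈-sym (strictlyInverseˡ (b ∙ to i)))))) ⟩
      inversionParity ((translation a ⟨$⟩ʳ_) ∘ (translation b ⟨$⟩ʳ_))
        ≡⟨ inversionParity-∘ (translation a) (translation b) ⟩
      sgn b xor sgn a
        ≡⟨ xor-comm (sgn b) (sgn a) ⟩
      sgn a xor sgn b ∎
      where open ≡-Reasoning

    sgn≡false⇒Alt : ∀ a → sgn a ≡ false → Alt en (ι a)
    sgn≡false⇒Alt a even = ¬odd⇒2∣ _ (trans (odd-length-filter-pairs {n} _) even)

    open Character sgn sgn-cong sgn-∙ public

    module _ {p : Level} (t : A) (C : G → Set p) (C-cong : ∀ g h → g ≈G h → C g → C h)
             (A∩Alt⊆C : ∀ a → Alt en (ι a) → ¬ ι a ≈G one → C (ι a))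
             (τA∩Alt⊆C : ∀ a → Alt en (ι a) → ¬ ((t , true) · ι a) ≈G one → C ((t , true) · ι a))
             where

      kernel⊆C : ∀ u → extend (sgn t) u ≡ false → ¬ u ≈G one → C u
      kernel⊆C (a , false) sgn-a u≉1 = A∩Alt⊆C a (sgn≡false⇒Alt a sgn-a) u≉1
      kernel⊆C (a , true) φu u≉1 =
        C-cong _ _ τb≈u (τA∩Alt⊆C b (sgn≡false⇒Alt b (trans sgn-b φu)) λ ())
        where
          b : A
          b = (t ⁻¹ ∙ a) ⁻¹
          sgn-b : sgn b ≡ sgn t xor sgn a
          sgn-b = trans (χ-⁻¹ (t ⁻¹ ∙ a)) (trans (sgn-∙ (t ⁻¹) a) (cong (_xor sgn a) (χ-⁻¹ t)))
          τb≈u : ((t , true) · ι b) ≈G (a , true)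
          τb≈u = (begin
            t ∙ (t ⁻¹ ∙ a) ⁻¹ ⁻¹ ≈⟨ ∙-congˡ (⁻¹-involutive (t ⁻¹ ∙ a)) ⟩
            t ∙ (t ⁻¹ ∙ a)       ≈⟨ assoc t (t ⁻¹) a ⟨
            (t ∙ t ⁻¹) ∙ a       ≈⟨ ∙-congʳ (inverseʳ t) ⟩
            ε ∙ a                ≈⟨ identityˡ a ⟩
            a                    ∎) , refl
            where open SetoidReasoning setoid

  inv·≈one⇒≈ : ∀ g h → (inv g · h) ≈G one → g ≈G h
  inv·≈one⇒≈ (a , false) (b , false) (a⁻¹b≈ε , _) =
    ≈-sym (x∙y⁻¹≈ε⇒x≈y b a (≈-trans (comm b (a ⁻¹)) a⁻¹b≈ε)) , refl
  inv·≈one⇒≈ (a , true) (b , true) (a⁻¹⁻¹b⁻¹≈ε , _) =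
    ≈-trans (≈-sym (⁻¹-involutive a)) (x∙y⁻¹≈ε⇒x≈y (a ⁻¹ ⁻¹) b a⁻¹⁻¹b⁻¹≈ε) , refl

  Der-ι : ∀ a → ¬ a ≈ ε → Der (ι a)
  Der-ι a a≉ε b ab≈b = a≉ε (∙-cancelʳ b a ε (≈-trans ab≈b (≈-sym (identityˡ b))))

  ¬Der-reflection : ∀ a → a ≈ ε → ¬ Der (a , true)
  ¬Der-reflection a a≈ε der = der ε (≈-trans (∙-congʳ a≈ε) (inverseʳ ε))

  module _ {p : Level} (S : G → Set p) (S⊆Der : ∀ g → S g → Der g) where

    independent-one-x : Independent S (one ∷ xG ∷ [])
    independent-one-x =
      (((λ ()) , (λ s → ¬Der-reflection _ (inverseˡ ε) (S⊆Der _ s))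
              , (λ s → ¬Der-reflection _ (inverseˡ (ε ⁻¹)) (S⊆Der _ s))) ∷ []) ∷ [] ∷ []

    length≤2 : ∀ (φ : G → Bool) → (∀ g h → φ g ≡ φ h → ¬ g ≈G h → Adj S g h) →
               ∀ L → Independent S L → length L ≤ 2
    length≤2 φ adjacent [] _ = z≤n
    length≤2 φ adjacent (_ ∷ []) _ = s≤s z≤n
    length≤2 φ adjacent (_ ∷ _ ∷ []) _ = s≤s (s≤s z≤n)
    length≤2 φ adjacent (g ∷ h ∷ k ∷ _)
             (((g≉h , ¬gh , _) ∷ (g≉k , ¬gk , _) ∷ _) ∷ ((h≉k , ¬hk , _) ∷ _) ∷ _)
      with pigeonhole (φ g) (φ h) (φ k)
    ... | inj₁ φg≡φh = ⊥-elim (¬gh (adjacent g h φg≡φh g≉h))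
    ... | inj₂ (inj₁ φg≡φk) = ⊥-elim (¬gk (adjacent g k φg≡φk g≉k))
    ... | inj₂ (inj₂ φh≡φk) = ⊥-elim (¬hk (adjacent h k φh≡φk h≉k))

    IndepNumber≡2 : ∀ (φ : G → Bool) →
                    (∀ g h → φ (g · h) ≡ φ g xor φ h) → (∀ g → φ (inv g) ≡ φ g) →
                    (∀ u → φ u ≡ false → ¬ u ≈G one → S u) → IndepNumber≡ S 2
    IndepNumber≡2 φ φ-· φ-inv kernel⊆S =
      (_ , independent-one-x , refl) , length≤2 φ adjacent
      where
        adjacent : ∀ g h → φ g ≡ φ h → ¬ g ≈G h → Adj S g h
        adjacent g h φg≡φh g≉h = kernel⊆S (inv g · h)
          (trans (φ-· (inv g) h) (trans (cong₂ _xor_ (φ-inv g) (sym φg≡φh)) (xor-same (φ g))))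
          (g≉h ∘ inv·≈one⇒≈ g h)

-- Only the hypotheses on τ's coset, on C and on A ∩ Alt(n) are needed; the parity of n,
-- the non-involution, the odd element of A, τ ∈ Der(G) and inverse-closedness of C are not.
lemma4p8 : ∀ {c ℓ p : Level} (𝔸 : AbelianGroup c ℓ) (n : ℕ)
    → (en : Inverse (≡.setoid (Fin n)) (AbelianGroup.setoid 𝔸))
    → 2 ∣ n
    → (∃[ a ] ¬ (AbelianGroup._≈_ 𝔸 (AbelianGroup._∙_ 𝔸 a a) (AbelianGroup.ε 𝔸)))
    → (∃[ a ] ¬ DA.Alt 𝔸 en (DA.ι 𝔸 a))
    → (τ : DA.G 𝔸) → proj₂ τ ≡ true → DA.Der 𝔸 τ
    → (C : DA.G 𝔸 → Set p)
    → (∀ g h → DA._≈G_ 𝔸 g h → C g → C h)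
    → (∀ g → C g → C (DA.inv 𝔸 g))
    → (∀ a → DA.Alt 𝔸 en (DA.ι 𝔸 a) → ¬ DA._≈G_ 𝔸 (DA.ι 𝔸 a) (DA.one 𝔸)
         → C (DA.ι 𝔸 a))
    → (∀ a → DA.Alt 𝔸 en (DA.ι 𝔸 a)
         → ¬ DA._≈G_ 𝔸 (DA._·_ 𝔸 τ (DA.ι 𝔸 a)) (DA.one 𝔸)
         → C (DA._·_ 𝔸 τ (DA.ι 𝔸 a)))
    → (∀ g → C g → DA.Der 𝔸 g)
    → DA.IndepNumber≡ 𝔸 C 2 × DA.IndepNumber≡ 𝔸 (DA.Der 𝔸) 2
lemma4p8 𝔸 n en _ _ _ (t , .true) refl _ C C-cong _ A∩Alt⊆C τA∩Alt⊆C C⊆Der =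
  IndepNumber≡2 C C⊆Der (extend (sgn t)) (extend-· (sgn t)) (extend-inv (sgn t))
                (kernel⊆C t C C-cong A∩Alt⊆C τA∩Alt⊆C) ,
  IndepNumber≡2 Der (λ _ der → der) proj₂ (λ _ _ → refl) (λ _ → refl) A∖1⊆Der
  where
    open DA 𝔸
    open Dihedral 𝔸
    open Sign en
    A∖1⊆Der : ∀ u → proj₂ u ≡ false → ¬ u ≈G one → Der u
    A∖1⊆Der (a , false) _ u≉1 = Der-ι a (λ a≈ε → u≉1 (a≈ε , refl))
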